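{- Define integers $g_k$ ($k\ge1$) by the power series identity $\sum_{k\ge1} g_k z^k=\sum_{n\ge0}\frac{z^{2^n}}{1-z^{2^n}}$. Let $J=\{(2n+1)2^{2j}-1 \mid n,j\ge 0 \text{ integers}\}$. Then for every integer $k\ge 0$, $g_{k+1}$ is odd if and only if $k\in J$. -}

module Defs where

open import Data.Nat using (ℕ; zero; suc; _+_; _*_; _^_; _≡ᵇ_)
open import Data.Nat.Divisibility using (_∣?_)
open import Data.List using (List; length; filter; upTo)
open import Relation.Binary.PropositionalEquality using (_≡_)
open import Data.Product using (∃₂)

-- Coefficient of z^k in  Σ_{n≥0} z^{2^n}/(1 - z^{2^n}) = Σ_{n≥0} Σ_{m≥1} z^{m·2^n}:
-- g k = #{ (n , m) | n ≥ 0, m ≥ 1, m * 2^n = k }.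
-- For k ≥ 1, each such pair is determined by n (m = k / 2^n), the pairs
-- correspond exactly to the n with 2^n ∣ k, and any such n satisfies n < 2^n ≤ k,
-- so n ranges over upTo (suc k) = [0 .. k].
g : ℕ → ℕ
g k = length (filter (λ n → 2 ^ n ∣? k) (upTo (suc k)))

InJ : ℕ → Set
InJ k = ∃₂ λ n j → suc k ≡ (2 * n + 1) * 2 ^ (2 * j)

{-# OPTIONS --safe #-}
module Submission where

-- Write k + 1 = (2m + 1)·2^a. Then 2^n ∣ k + 1 exactly for n ≤ a, so g (k + 1) = a + 1, which is
-- odd iff a is even, i.e. iff the power of two in k + 1 is a power of 4.

open import Defs
open import Data.Nat using (ℕ; zero; suc; _+_; _*_; _^_; _%_; _⊓_; _≤_; _<_; z≤n; s≤s; >-nonZero)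
open import Data.Nat.Properties
open import Data.Nat.Divisibility
open import Data.Nat.DivMod using (%-remove-+ʳ)
open import Algebra.Properties.CommutativeSemigroup *-commutativeSemigroup using (x∙yz≈y∙xz)
open import Data.Nat.Induction using (<-rec)
open import Data.List using ([]; [_]; _++_; length; filter; upTo)
open import Data.List.Properties using (upTo-∷ʳ; filter-++; length-++; filter-accept; filter-reject)
open import Data.Product using (∃; ∃₂; _,_)
open import Data.Sum using (_⊎_; inj₁; inj₂)
open import Function.Base using (_∘_)
open import Function.Bundles using (_⇔_; mk⇔; Equivalence)
open import Relation.Nullary using (yes; no; contradiction)
open import Relation.Unary using (Pred; Decidable)
open import Relation.Binary.PropositionalEquality using (_≡_; refl; sym; trans; cong; subst; module ≡-Reasoning)

^-monoʳ-∣ : ∀ b {m n} → m ≤ n → b ^ m ∣ b ^ n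
^-monoʳ-∣ b {n = n} z≤n = 1∣ (b ^ n)
^-monoʳ-∣ b (s≤s m≤n) = *-monoʳ-∣ b (^-monoʳ-∣ b m≤n)

n<2^n : ∀ n → n < 2 ^ n
n<2^n zero = s≤s z≤n
n<2^n (suc n) = begin-strict
  suc n           ≡⟨ +-comm 1 n ⟩
  n + 1           <⟨ +-mono-<-≤ (n<2^n n) (m^n>0 2 n) ⟩
  2 ^ n + 2 ^ n   ≡⟨ cong (2 ^ n +_) (sym (+-identityʳ (2 ^ n))) ⟩
  2 ^ suc n       ∎
  where open ≤-Reasoning

2∤2m+1 : ∀ m → 2 ∤ 2 * m + 1
2∤2m+1 m (divides q 2m+1≡q*2) = even≢odd q m (begin
  2 * q      ≡⟨ *-comm 2 q ⟩
  q * 2      ≡⟨ 2m+1≡q*2 ⟨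
  2 * m + 1  ≡⟨ +-comm (2 * m) 1 ⟩
  1 + 2 * m  ∎)
  where open ≡-Reasoning

2^n∣[2m+1]*2^a⇔n≤a : ∀ m a n → 2 ^ n ∣ (2 * m + 1) * 2 ^ a ⇔ n ≤ a
2^n∣[2m+1]*2^a⇔n≤a m a n = mk⇔ to from
  where
  to : 2 ^ n ∣ (2 * m + 1) * 2 ^ a → n ≤ a
  to 2^n∣x with n ≤? a
  ... | yes n≤a = n≤a
  ... | no n≰a = contradiction
    (*-cancelʳ-∣ (2 ^ a) {{m^n≢0 2 a}} (∣-trans (^-monoʳ-∣ 2 (≰⇒> n≰a)) 2^n∣x))
    (2∤2m+1 m)
  from : n ≤ a → 2 ^ n ∣ (2 * m + 1) * 2 ^ a
  from n≤a = ∣-trans (^-monoʳ-∣ 2 n≤a) (n∣m*n (2 * m + 1))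

module _ {p} {P : Pred ℕ p} (P? : Decidable P) {a : ℕ} (P⇔≤a : ∀ n → P n ⇔ n ≤ a) where

  length-filter-upTo : ∀ N → length (filter P? (upTo N)) ≡ N ⊓ suc a
  length-filter-upTo zero = refl
  length-filter-upTo (suc N) = begin
    length (filter P? (upTo (suc N)))                   ≡⟨ cong (length ∘ filter P?) (upTo-∷ʳ N) ⟨
    length (filter P? (upTo N ++ [ N ]))                ≡⟨ cong length (filter-++ P? (upTo N) [ N ]) ⟩
    length (filter P? (upTo N) ++ filter P? [ N ])      ≡⟨ length-++ (filter P? (upTo N)) ⟩
    length (filter P? (upTo N)) + length (filter P? [ N ])
                                                        ≡⟨ cong (_+ _) (length-filter-upTo N) ⟩
    N ⊓ suc a + length (filter P? [ N ])                ≡⟨ last-step ⟩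
    suc N ⊓ suc a                                       ∎
    where
    open ≡-Reasoning
    last-step : N ⊓ suc a + length (filter P? [ N ]) ≡ suc N ⊓ suc a
    last-step with N ≤? a
    ... | yes N≤a rewrite filter-accept P? {xs = []} (Equivalence.from (P⇔≤a N) N≤a)
                        | m≤n⇒m⊓n≡m (m≤n⇒m≤1+n N≤a) | m≤n⇒m⊓n≡m N≤a = +-comm N 1
    ... | no N≰a rewrite filter-reject P? {xs = []} (N≰a ∘ Equivalence.to (P⇔≤a N))
                       | m≥n⇒m⊓n≡n (≰⇒> N≰a) | m≥n⇒m⊓n≡n (<⇒≤ (≰⇒> N≰a)) = +-identityʳ (suc a)

g[[2m+1]*2^a]≡1+a : ∀ m a → g ((2 * m + 1) * 2 ^ a) ≡ suc a
g[[2m+1]*2^a]≡1+a m a = begin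
  g x                  ≡⟨ length-filter-upTo (λ n → 2 ^ n ∣? x) (2^n∣[2m+1]*2^a⇔n≤a m a) (suc x) ⟩
  suc x ⊓ suc a        ≡⟨ m≥n⇒m⊓n≡n (s≤s a≤x) ⟩
  suc a                ∎
  where
  open ≡-Reasoning
  x = (2 * m + 1) * 2 ^ a
  a≤x : a ≤ x
  a≤x = ≤-trans (<⇒≤ (n<2^n a)) (m≤n*m (2 ^ a) (2 * m + 1) {{>-nonZero (m≤n+m 1 (2 * m))}})

even⊎odd : ∀ n → ∃ λ j → n ≡ 2 * j ⊎ n ≡ 1 + 2 * j
even⊎odd zero = 0 , inj₁ refl
even⊎odd (suc n) with even⊎odd n
... | j , inj₁ refl = j , inj₂ refl
... | j , inj₂ refl = suc j , inj₁ (sym (*-suc 2 j))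

suc≡[2m+1]*2^a : ∀ k → ∃₂ λ m a → suc k ≡ (2 * m + 1) * 2 ^ a
suc≡[2m+1]*2^a = <-rec _ decompose
  where
  decompose : ∀ k → (∀ {i} → i < k → ∃₂ λ m a → suc i ≡ (2 * m + 1) * 2 ^ a) →
              ∃₂ λ m a → suc k ≡ (2 * m + 1) * 2 ^ a
  decompose k rec with even⊎odd k
  ... | j , inj₁ refl = j , 0 , sym (trans (*-identityʳ (2 * j + 1)) (+-comm (2 * j) 1))
  ... | j , inj₂ refl with rec {j} (s≤s (m≤m+n j (j + 0)))
  ...   | m , a , 1+j≡ = m , suc a , (begin
    2 + 2 * j                 ≡⟨ *-suc 2 j ⟨
    2 * suc j                 ≡⟨ cong (2 *_) 1+j≡ ⟩
    2 * ((2 * m + 1) * 2 ^ a) ≡⟨ x∙yz≈y∙xz 2 (2 * m + 1) (2 ^ a) ⟩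
    (2 * m + 1) * 2 ^ suc a   ∎)
    where open ≡-Reasoning

[1+n]%2≡1⇔even : ∀ n → suc n % 2 ≡ 1 ⇔ ∃ λ j → n ≡ 2 * j
[1+n]%2≡1⇔even n = mk⇔ to from
  where
  to : suc n % 2 ≡ 1 → ∃ λ j → n ≡ 2 * j
  to [1+n]%2≡1 with even⊎odd n
  ... | j , inj₁ n≡2j = j , n≡2j
  ... | j , inj₂ refl = contradiction (trans (sym (%-remove-+ʳ 2 {d = 2} (m∣m*n j))) [1+n]%2≡1) λ ()
  from : ∃ (λ j → n ≡ 2 * j) → suc n % 2 ≡ 1
  from (j , refl) = %-remove-+ʳ 1 {d = 2} (m∣m*n j)

lemma1 : (k : ℕ) → (g (suc k) % 2 ≡ 1) ⇔ InJ k
lemma1 k = mk⇔ to from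
  where
  g[1+k]≡1+a : ∀ m a → suc k ≡ (2 * m + 1) * 2 ^ a → g (suc k) ≡ suc a
  g[1+k]≡1+a m a 1+k≡ = trans (cong g 1+k≡) (g[[2m+1]*2^a]≡1+a m a)

  to : g (suc k) % 2 ≡ 1 → InJ k
  to g[1+k]%2≡1 with suc≡[2m+1]*2^a k
  ... | m , a , 1+k≡ with Equivalence.to ([1+n]%2≡1⇔even a)
                            (subst (λ x → x % 2 ≡ 1) (g[1+k]≡1+a m a 1+k≡) g[1+k]%2≡1)
  ...   | j , refl = m , j , 1+k≡

  from : InJ k → g (suc k) % 2 ≡ 1
  from (n , j , 1+k≡) = subst (λ x → x % 2 ≡ 1) (sym (g[1+k]≡1+a n (2 * j) 1+k≡))
                              (Equivalence.from ([1+n]%2≡1⇔even (2 * j)) (j , refl))
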